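{- Let \[B_0=\begin{pmatrix}2&0&0&0\\0&1&0&0\\0&1&0&1\\0&-1&1&0\end{pmatrix},\qquad B_1=\begin{pmatrix}0&0&2&0\\0&0&0&1\\0&-1&1&1\\0&2&0&1\end{pmatrix},\] and $\mathcal{B}=\{B_0,B_1\}$. Then the joint spectral radius of $\mathcal{B}$ is $2$, and $\mathcal{B}$ has the simple growth property.
   Context: For a finite set $\mathcal{H}$ of square complex matrices and an induced matrix norm, the joint spectral radius is $\rho(\mathcal{H})=\lim_{k\to\infty}\sup\{\|H_1\cdots H_k\|^{1/k}:H_i\in\mathcal{H}\}$; $\mathcal{H}$ has the simple growth property if $\|H_1\cdots H_k\|=O(\rho(\mathcal{H})^k)$ uniformly over $H_1,\dots,H_k\in\mathcal{H}$ as $k\to\infty$. -}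

module Defs where

open import Data.Nat using (ℕ; zero; suc; _⊔_; _≤_; _<_; _≥_) renaming (_∸_ to _∸'_; _*_ to _*ℕ_; _+_ to _+ℕ_; _^_ to _^ℕ_)
open import Data.Integer using (ℤ; +_; -[1+_]; ∣_∣; _+_; _*_; -_)
open import Data.Fin using (Fin; zero; suc)
open import Data.List using (List; []; _∷_; map; foldr; concatMap; allFin)
open import Data.Vec using (Vec; []; _∷_; lookup)
open import Data.Product using (Σ; _×_; ∃)

Mat : ℕ → Set
Mat d = Fin d → Fin d → ℤ

sumℤ : List ℤ → ℤ
sumℤ = foldr _+_ (+ 0)

sumℕ : List ℕ → ℕ
sumℕ = foldr _+ℕ_ 0

maxℕ : List ℕ → ℕ
maxℕ = foldr _⊔_ 0

_⊗_ : ∀ {d} → Mat d → Mat d → Mat d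
(A ⊗ B) i j = sumℤ (map (λ l → A i l * B l j) (allFin _))

I : ∀ {d} → Mat d
I zero    zero    = + 1
I zero    (suc _) = + 0
I (suc _) zero    = + 0
I (suc i) (suc j) = I i j

-- The matrix norm induced by the ∞-vector norm: maximal absolute row sum.
-- (Both the JSR and the simple growth property are independent of the
-- choice of induced norm.)
‖_‖∞ : ∀ {d} → Mat d → ℕ
‖ A ‖∞ = maxℕ (map (λ i → sumℕ (map (λ j → ∣ A i j ∣) (allFin _))) (allFin _))

prod : ∀ {d m k} → (Fin m → Mat d) → Vec (Fin m) k → Mat d
prod H []      = I
prod H (i ∷ w) = H i ⊗ prod H w

words : (m k : ℕ) → List (Vec (Fin m) k)
words m zero    = [] ∷ []
words m (suc k) = concatMap (λ i → map (i ∷_) (words m k)) (allFin m)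

supNorm : ∀ {d m} → (Fin m → Mat d) → ℕ → ℕ
supNorm H k = maxℕ (map (λ w → ‖ prod H w ‖∞) (words _ k))

-- ρ(ℋ) = r  (r a natural number), i.e.
-- lim_{k→∞} (supNorm k)^{1/k} = r, written out with ε = 1/(n+1):
-- for every n there is N such that for all k ≥ N,
--   r - 1/(n+1) < (supNorm k)^{1/k} < r + 1/(n+1),
-- which (raising to the k-th power, clearing denominators) reads
--   (r(n+1) - 1)^k < supNorm k · (n+1)^k < (r(n+1) + 1)^k.
JSR≡ : ∀ {d m} → (Fin m → Mat d) → ℕ → Set
JSR≡ H r = (n : ℕ) → Σ ℕ λ N → (k : ℕ) → k ≥ N →
  ((r *ℕ suc n ∸' 1) ^ℕ k < supNorm H k *ℕ (suc n ^ℕ k))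
  × (supNorm H k *ℕ (suc n ^ℕ k) < (r *ℕ suc n +ℕ 1) ^ℕ k)

SimpleGrowth : ∀ {d m} → (Fin m → Mat d) → ℕ → Set
SimpleGrowth H r = Σ ℕ λ C → Σ ℕ λ K → (k : ℕ) → k ≥ K →
  (w : Vec (Fin _) k) → ‖ prod H w ‖∞ ≤ C *ℕ (r ^ℕ k)

mat4 : Vec (Vec ℤ 4) 4 → Mat 4
mat4 rows i j = lookup (lookup rows i) j

B₀ : Mat 4
B₀ = mat4 ( (+ 2 ∷ + 0 ∷ + 0 ∷ + 0 ∷ [])
          ∷ (+ 0 ∷ + 1 ∷ + 0 ∷ + 0 ∷ [])
          ∷ (+ 0 ∷ + 1 ∷ + 0 ∷ + 1 ∷ [])
          ∷ (+ 0 ∷ -[1+ 0 ] ∷ + 1 ∷ + 0 ∷ [])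
          ∷ [])

B₁ : Mat 4
B₁ = mat4 ( (+ 0 ∷ + 0 ∷ + 2 ∷ + 0 ∷ [])
          ∷ (+ 0 ∷ + 0 ∷ + 0 ∷ + 1 ∷ [])
          ∷ (+ 0 ∷ -[1+ 0 ] ∷ + 1 ∷ + 1 ∷ [])
          ∷ (+ 0 ∷ + 2 ∷ + 0 ∷ + 1 ∷ [])
          ∷ [])

𝓑 : Fin 2 → Mat 4
𝓑 zero    = B₀
𝓑 (suc _) = B₁

{-# OPTIONS --safe #-}
-- The gauge ν(a, b, c, d) = max(2|a|, 2|b|, 2|c|, 2|d|, |c + d − b|, |2b + d|) on columns
-- satisfies ν(B₀ v) ≤ 2 ν(v) and ν(B₁ v) ≤ 2 ν(v): each of the six quantities defining
-- ν(Bᵢ v) is a sum of two quantities bounded by ν(v). The columns of the identity have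
-- ν ≤ 2, so every entry of a product of k matrices from 𝓑 is at most 2ᵏ and its ∞-norm
-- at most 4 · 2ᵏ, which is the simple growth property. The top-left entry of B₀ᵏ is 2ᵏ,
-- so 2ᵏ ≤ sup ‖H₁ ⋯ Hₖ‖ ≤ 4 · 2ᵏ, and the joint spectral radius is 2 because 4^{1/k} → 1,
-- quantitatively: c · mᵏ < (m + 1)ᵏ as soon as k > c m (a Bernoulli-type inequality).
module Submission where

open import Defs
open import Data.Fin using (Fin; zero; suc)
open import Data.Integer using (ℤ; +_; -[1+_]; ∣_∣)
open import Data.List using (List; []; _∷_; map; length; allFin)
open import Data.List.Properties using (length-tabulate)
open import Data.Nat as ℕ using (ℕ; zero; suc; _≤_; _<_; _≥_; z≤n; s≤s; NonZero)
open import Data.Nat.Properties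
open import Data.Product using (_×_; _,_; ∃)
open import Data.Vec using (Vec; []; _∷_; replicate)
open import Relation.Binary.PropositionalEquality using (_≡_; refl; sym; cong; subst; module ≡-Reasoning)

module _ where
  open import Data.Nat using (_+_; _*_; _^_; _∸_)
  open import Data.Nat.Tactic.RingSolver using (solve-∀)
  open import Algebra.Properties.CommutativeSemigroup *-commutativeSemigroup
    using (x∙yz≈y∙xz; xy∙z≈y∙xz)

  [m*n]^k≡m^k*n^k : ∀ m n k → (m * n) ^ k ≡ m ^ k * n ^ k
  [m*n]^k≡m^k*n^k m n zero    = refl
  [m*n]^k≡m^k*n^k m n (suc k) = begin
    m * n * (m * n) ^ k        ≡⟨ cong (m * n *_) ([m*n]^k≡m^k*n^k m n k) ⟩
    m * n * (m ^ k * n ^ k)    ≡⟨ [m*n]*[o*p]≡[m*o]*[n*p] m n (m ^ k) (n ^ k) ⟩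
    m * m ^ k * (n * n ^ k)    ∎
    where open ≡-Reasoning

  m^k*[m+k]≤[m+1]^k*m : ∀ m k → m ^ k * (m + k) ≤ (m + 1) ^ k * m
  m^k*[m+k]≤[m+1]^k*m m zero    = ≤-reflexive (cong (1 *_) (+-identityʳ m))
  m^k*[m+k]≤[m+1]^k*m m (suc k) = begin
    m * m ^ k * (m + suc k)        ≡⟨ xy∙z≈y∙xz m (m ^ k) (m + suc k) ⟩
    m ^ k * (m * (m + suc k))      ≤⟨ *-monoʳ-≤ (m ^ k) (≤-trans (m≤m+n _ k) (≤-reflexive (expand m k))) ⟩
    m ^ k * ((m + 1) * (m + k))    ≡⟨ x∙yz≈y∙xz (m ^ k) (m + 1) (m + k) ⟩
    (m + 1) * (m ^ k * (m + k))    ≤⟨ *-monoʳ-≤ (m + 1) (m^k*[m+k]≤[m+1]^k*m m k) ⟩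
    (m + 1) * ((m + 1) ^ k * m)    ≡⟨ sym (*-assoc (m + 1) _ m) ⟩
    (m + 1) * (m + 1) ^ k * m      ∎
    where
    open ≤-Reasoning
    expand : ∀ x y → x * (x + suc y) + y ≡ (x + 1) * (x + y)
    expand = solve-∀

  c*m^k<[m+1]^k : ∀ c m k .{{_ : NonZero m}} → c * m < k → c * m ^ k < (m + 1) ^ k
  c*m^k<[m+1]^k c m k cm<k = *-cancelʳ-< m _ _ (begin-strict
    c * m ^ k * m     ≡⟨ xy∙z≈y∙xz c (m ^ k) m ⟩
    m ^ k * (c * m)   <⟨ *-monoʳ-< (m ^ k) {{m^n≢0 m k}} (<-≤-trans cm<k (m≤n+m k m)) ⟩
    m ^ k * (m + k)   ≤⟨ m^k*[m+k]≤[m+1]^k*m m k ⟩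
    (m + 1) ^ k * m   ∎)
    where open ≤-Reasoning

  JSR≡-from-sandwich : ∀ {d m} (H : Fin m → Mat d) r c .{{_ : NonZero r}} →
    (∀ k → r ^ k ≤ supNorm H k) → (∀ k → supNorm H k ≤ c * r ^ k) → JSR≡ H r
  JSR≡-from-sandwich H r c lower upper n = suc (c * m) , bounds
    where
    m = r * suc n
    instance
      m≢0 : NonZero m
      m≢0 = m*n≢0 r (suc n)
    m∸1<m : ∀ m .{{_ : NonZero m}} → m ∸ 1 < m
    m∸1<m (suc m) = n<1+n m
    bounds : ∀ k → k ≥ suc (c * m) →
      ((m ∸ 1) ^ k < supNorm H k * suc n ^ k) × (supNorm H k * suc n ^ k < (m + 1) ^ k)
    bounds k@(suc _) k>cm = lower-bound , upper-bound
      where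
      open ≤-Reasoning
      lower-bound : (m ∸ 1) ^ k < supNorm H k * suc n ^ k
      lower-bound = begin-strict
        (m ∸ 1) ^ k                <⟨ ^-monoˡ-< k (m∸1<m m) ⟩
        m ^ k                      ≡⟨ [m*n]^k≡m^k*n^k r (suc n) k ⟩
        r ^ k * suc n ^ k          ≤⟨ *-monoˡ-≤ (suc n ^ k) (lower k) ⟩
        supNorm H k * suc n ^ k    ∎
      upper-bound : supNorm H k * suc n ^ k < (m + 1) ^ k
      upper-bound = begin-strict
        supNorm H k * suc n ^ k    ≤⟨ *-monoˡ-≤ (suc n ^ k) (upper k) ⟩
        c * r ^ k * suc n ^ k      ≡⟨ *-assoc c (r ^ k) (suc n ^ k) ⟩
        c * (r ^ k * suc n ^ k)    ≡⟨ cong (c *_) ([m*n]^k≡m^k*n^k r (suc n) k) ⟨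
        c * m ^ k                  <⟨ c*m^k<[m+1]^k c m k k>cm ⟩
        (m + 1) ^ k                ∎

  maxℕ-map-≤ : ∀ {A : Set} (f : A → ℕ) {b} (xs : List A) → (∀ x → f x ≤ b) → maxℕ (map f xs) ≤ b
  maxℕ-map-≤ f []       f≤b = z≤n
  maxℕ-map-≤ f (x ∷ xs) f≤b = ⊔-lub (f≤b x) (maxℕ-map-≤ f xs f≤b)

  sumℕ-map-≤ : ∀ {A : Set} (f : A → ℕ) {b} (xs : List A) → (∀ x → f x ≤ b) →
    sumℕ (map f xs) ≤ length xs * b
  sumℕ-map-≤ f []       f≤b = z≤n
  sumℕ-map-≤ f (x ∷ xs) f≤b = +-mono-≤ (f≤b x) (sumℕ-map-≤ f xs f≤b)

  ∣entries∣≤b⇒‖‖∞≤d*b : ∀ {d} (M : Mat d) {b} → (∀ i j → ∣ M i j ∣ ≤ b) → ‖ M ‖∞ ≤ d * b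
  ∣entries∣≤b⇒‖‖∞≤d*b {d} M {b} ∣M∣≤b = maxℕ-map-≤ _ (allFin d) row-sum≤d*b
    where
    row-sum≤d*b : ∀ i → sumℕ (map (λ j → ∣ M i j ∣) (allFin d)) ≤ d * b
    row-sum≤d*b i = subst (λ n → sumℕ (map (λ j → ∣ M i j ∣) (allFin d)) ≤ n * b)
      (length-tabulate {n = d} (λ j → j))
      (sumℕ-map-≤ _ (allFin d) (∣M∣≤b i))

  ∣entry₀₀∣≤‖‖∞ : ∀ {d} (M : Mat (suc d)) → ∣ M zero zero ∣ ≤ ‖ M ‖∞
  ∣entry₀₀∣≤‖‖∞ M = ≤-trans (m≤m+n _ _) (m≤m⊔n _ _)

  words≡replicate-zero∷ : ∀ m k → ∃ λ ws → words (suc m) k ≡ replicate k zero ∷ ws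
  words≡replicate-zero∷ m zero = _ , refl
  words≡replicate-zero∷ m (suc k) with words (suc m) k | words≡replicate-zero∷ m k
  ... | _ | ws , refl = _ , refl

  ‖prod-replicate-zero‖∞≤supNorm : ∀ {d m} (H : Fin (suc m) → Mat d) k →
    ‖ prod H (replicate k zero) ‖∞ ≤ supNorm H k
  ‖prod-replicate-zero‖∞≤supNorm {m = m} H k with words (suc m) k | words≡replicate-zero∷ m k
  ... | _ | ws , refl = m≤m⊔n _ _

  ‖prod‖∞≤b⇒supNorm≤b : ∀ {d m} (H : Fin m → Mat d) {b} k → (∀ w → ‖ prod H w ‖∞ ≤ b) →
    supNorm H k ≤ b
  ‖prod‖∞≤b⇒supNorm≤b H k = maxℕ-map-≤ _ (words _ k)

module _ where
  open import Data.Fin.Patterns using (0F; 1F; 2F; 3F)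
  open import Data.Integer using (_+_; _*_; -_)
  open import Data.Integer.Properties using (∣i+j∣≤∣i∣+∣j∣; ∣-i∣≡∣i∣; abs-*; pos-*)
  open import Data.Integer.Tactic.RingSolver using (solve-∀; solve)

  InBall : ℕ → ℤ → ℤ → ℤ → ℤ → Set
  InBall t a b c d = ∣ + 2 * a ∣ ≤ t × ∣ + 2 * b ∣ ≤ t × ∣ + 2 * c ∣ ≤ t × ∣ + 2 * d ∣ ≤ t
    × ∣ - b + c + d ∣ ≤ t × ∣ + 2 * b + d ∣ ≤ t

  ∣i∣≤∣2i∣ : ∀ i → ∣ i ∣ ≤ ∣ + 2 * i ∣
  ∣i∣≤∣2i∣ i = subst (∣ i ∣ ≤_) (sym (abs-* (+ 2) i)) (m≤m+n ∣ i ∣ _)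

  x≡i+j⇒∣x∣≤2t : ∀ {t} x i j → x ≡ i + j → ∣ i ∣ ≤ t → ∣ j ∣ ≤ t → ∣ x ∣ ≤ 2 ℕ.* t
  x≡i+j⇒∣x∣≤2t x i j refl ∣i∣≤t ∣j∣≤t =
    ≤-trans (∣i+j∣≤∣i∣+∣j∣ i j) (+-mono-≤ ∣i∣≤t (m≤n⇒m≤n+o 0 ∣j∣≤t))

  InBall-B₀ : ∀ {t} a b c d → InBall t a b c d →
    InBall (2 ℕ.* t) (+ 2 * a) b (b + d) (- b + c)
  InBall-B₀ {t} a b c d (∣2a∣ , ∣2b∣ , ∣2c∣ , ∣2d∣ , ∣c+d-b∣ , ∣2b+d∣) =
      x≡i+j⇒∣x∣≤2t (+ 2 * (+ 2 * a)) (+ 2 * a) (+ 2 * a) (solve vs) ∣2a∣ ∣2a∣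
    , x≡i+j⇒∣x∣≤2t (+ 2 * b) b b (solve vs) ∣b∣ ∣b∣
    , x≡i+j⇒∣x∣≤2t (+ 2 * (b + d)) (+ 2 * b + d) d (solve vs) ∣2b+d∣ ∣d∣
    , x≡i+j⇒∣x∣≤2t (+ 2 * (- b + c)) (- (+ 2 * b)) (+ 2 * c) (solve vs) ∣-2b∣ ∣2c∣
    , x≡i+j⇒∣x∣≤2t (- b + (b + d) + (- b + c)) (- b + c + d) (+ 0) (solve vs) ∣c+d-b∣ z≤n
    , x≡i+j⇒∣x∣≤2t (+ 2 * b + (- b + c)) b c (solve vs) ∣b∣ ∣c∣
    where
    vs = a ∷ b ∷ c ∷ d ∷ []
    ∣b∣ = ≤-trans (∣i∣≤∣2i∣ b) ∣2b∣
    ∣c∣ = ≤-trans (∣i∣≤∣2i∣ c) ∣2c∣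
    ∣d∣ = ≤-trans (∣i∣≤∣2i∣ d) ∣2d∣
    ∣-2b∣ = subst (_≤ t) (sym (∣-i∣≡∣i∣ (+ 2 * b))) ∣2b∣

  InBall-B₁ : ∀ {t} a b c d → InBall t a b c d →
    InBall (2 ℕ.* t) (+ 2 * c) d (- b + c + d) (+ 2 * b + d)
  InBall-B₁ {t} a b c d (_ , ∣2b∣ , ∣2c∣ , ∣2d∣ , ∣c+d-b∣ , ∣2b+d∣) =
      x≡i+j⇒∣x∣≤2t (+ 2 * (+ 2 * c)) (+ 2 * c) (+ 2 * c) (solve vs) ∣2c∣ ∣2c∣
    , x≡i+j⇒∣x∣≤2t (+ 2 * d) d d (solve vs) ∣d∣ ∣d∣
    , x≡i+j⇒∣x∣≤2t (+ 2 * (- b + c + d)) (- b + c + d) (- b + c + d) (solve vs) ∣c+d-b∣ ∣c+d-b∣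
    , x≡i+j⇒∣x∣≤2t (+ 2 * (+ 2 * b + d)) (+ 2 * b + d) (+ 2 * b + d) (solve vs) ∣2b+d∣ ∣2b+d∣
    , x≡i+j⇒∣x∣≤2t (- d + (- b + c + d) + (+ 2 * b + d)) (- b + c + d) (+ 2 * b) (solve vs)
        ∣c+d-b∣ ∣2b∣
    , x≡i+j⇒∣x∣≤2t (+ 2 * d + (+ 2 * b + d)) (+ 2 * b + d) (+ 2 * d) (solve vs) ∣2b+d∣ ∣2d∣
    where
    vs = a ∷ b ∷ c ∷ d ∷ []
    ∣d∣ = ≤-trans (∣i∣≤∣2i∣ d) ∣2d∣

  -- The entries of B₀ ⊗ M and B₁ ⊗ M as _⊗_ unfolds them.
  B₀-row₀ : ∀ a b c d → + 2 * a + (+ 0 * b + (+ 0 * c + (+ 0 * d + + 0))) ≡ + 2 * a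
  B₀-row₁ : ∀ a b c d → + 0 * a + (+ 1 * b + (+ 0 * c + (+ 0 * d + + 0))) ≡ b
  B₀-row₂ : ∀ a b c d → + 0 * a + (+ 1 * b + (+ 0 * c + (+ 1 * d + + 0))) ≡ b + d
  B₀-row₃ : ∀ a b c d → + 0 * a + (-[1+ 0 ] * b + (+ 1 * c + (+ 0 * d + + 0))) ≡ - b + c
  B₀-row₀ = solve-∀
  B₀-row₁ = solve-∀
  B₀-row₂ = solve-∀
  B₀-row₃ = solve-∀

  B₁-row₀ : ∀ a b c d → + 0 * a + (+ 0 * b + (+ 2 * c + (+ 0 * d + + 0))) ≡ + 2 * c
  B₁-row₁ : ∀ a b c d → + 0 * a + (+ 0 * b + (+ 0 * c + (+ 1 * d + + 0))) ≡ d
  B₁-row₂ : ∀ a b c d → + 0 * a + (-[1+ 0 ] * b + (+ 1 * c + (+ 1 * d + + 0))) ≡ - b + c + d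
  B₁-row₃ : ∀ a b c d → + 0 * a + (+ 2 * b + (+ 0 * c + (+ 1 * d + + 0))) ≡ + 2 * b + d
  B₁-row₀ = solve-∀
  B₁-row₁ = solve-∀
  B₁-row₂ = solve-∀
  B₁-row₃ = solve-∀

  ColumnInBall : ℕ → Mat 4 → Fin 4 → Set
  ColumnInBall t M j = InBall t (M 0F j) (M 1F j) (M 2F j) (M 3F j)

  ColumnInBall-B₀⊗ : ∀ {t} M j → ColumnInBall t M j → ColumnInBall (2 ℕ.* t) (B₀ ⊗ M) j
  ColumnInBall-B₀⊗ M j
    rewrite B₀-row₀ (M 0F j) (M 1F j) (M 2F j) (M 3F j)
          | B₀-row₁ (M 0F j) (M 1F j) (M 2F j) (M 3F j)
          | B₀-row₂ (M 0F j) (M 1F j) (M 2F j) (M 3F j)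
          | B₀-row₃ (M 0F j) (M 1F j) (M 2F j) (M 3F j) = InBall-B₀ (M 0F j) (M 1F j) (M 2F j) (M 3F j)

  ColumnInBall-B₁⊗ : ∀ {t} M j → ColumnInBall t M j → ColumnInBall (2 ℕ.* t) (B₁ ⊗ M) j
  ColumnInBall-B₁⊗ M j
    rewrite B₁-row₀ (M 0F j) (M 1F j) (M 2F j) (M 3F j)
          | B₁-row₁ (M 0F j) (M 1F j) (M 2F j) (M 3F j)
          | B₁-row₂ (M 0F j) (M 1F j) (M 2F j) (M 3F j)
          | B₁-row₃ (M 0F j) (M 1F j) (M 2F j) (M 3F j) = InBall-B₁ (M 0F j) (M 1F j) (M 2F j) (M 3F j)

  ColumnInBall-I : ∀ j → ColumnInBall 2 I j
  ColumnInBall-I 0F = ≤-refl , z≤n , z≤n , z≤n , z≤n , z≤n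
  ColumnInBall-I 1F = z≤n , ≤-refl , z≤n , z≤n , s≤s z≤n , ≤-refl
  ColumnInBall-I 2F = z≤n , z≤n , ≤-refl , z≤n , s≤s z≤n , z≤n
  ColumnInBall-I 3F = z≤n , z≤n , z≤n , ≤-refl , s≤s z≤n , s≤s z≤n

  ColumnInBall-prod : ∀ {k} (w : Vec (Fin 2) k) j → ColumnInBall (2 ℕ.* 2 ℕ.^ k) (prod 𝓑 w) j
  ColumnInBall-prod []          j = ColumnInBall-I j
  ColumnInBall-prod (zero  ∷ w) j = ColumnInBall-B₀⊗ (prod 𝓑 w) j (ColumnInBall-prod w j)
  ColumnInBall-prod (suc _ ∷ w) j = ColumnInBall-B₁⊗ (prod 𝓑 w) j (ColumnInBall-prod w j)

  ColumnInBall⇒∣2*entry∣≤ : ∀ {t} M j → ColumnInBall t M j → ∀ i → ∣ + 2 * M i j ∣ ≤ t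
  ColumnInBall⇒∣2*entry∣≤ M j (h , _)             0F = h
  ColumnInBall⇒∣2*entry∣≤ M j (_ , h , _)         1F = h
  ColumnInBall⇒∣2*entry∣≤ M j (_ , _ , h , _)     2F = h
  ColumnInBall⇒∣2*entry∣≤ M j (_ , _ , _ , h , _) 3F = h

  ∣prod𝓑-entry∣≤2ᵏ : ∀ {k} (w : Vec (Fin 2) k) i j → ∣ prod 𝓑 w i j ∣ ≤ 2 ℕ.^ k
  ∣prod𝓑-entry∣≤2ᵏ w i j = *-cancelˡ-≤ 2 (subst (_≤ _) (abs-* (+ 2) (prod 𝓑 w i j))
    (ColumnInBall⇒∣2*entry∣≤ (prod 𝓑 w) j (ColumnInBall-prod w j) i))

  B₀ᵏ-entry₀₀≡2ᵏ : ∀ k → prod 𝓑 (replicate k zero) 0F 0F ≡ + (2 ℕ.^ k)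
  B₀ᵏ-entry₀₀≡2ᵏ zero    = refl
  B₀ᵏ-entry₀₀≡2ᵏ (suc k) = begin
    (B₀ ⊗ M) 0F 0F    ≡⟨ B₀-row₀ (M 0F 0F) (M 1F 0F) (M 2F 0F) (M 3F 0F) ⟩
    + 2 * M 0F 0F     ≡⟨ cong (+ 2 *_) (B₀ᵏ-entry₀₀≡2ᵏ k) ⟩
    + 2 * + (2 ℕ.^ k) ≡⟨ pos-* 2 (2 ℕ.^ k) ⟨
    + (2 ℕ.^ suc k)   ∎
    where
    open ≡-Reasoning
    M = prod 𝓑 (replicate k zero)

  ‖prod𝓑‖∞≤4*2ᵏ : ∀ {k} (w : Vec (Fin 2) k) → ‖ prod 𝓑 w ‖∞ ≤ 4 ℕ.* 2 ℕ.^ k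
  ‖prod𝓑‖∞≤4*2ᵏ w = ∣entries∣≤b⇒‖‖∞≤d*b (prod 𝓑 w) (∣prod𝓑-entry∣≤2ᵏ w)

  2ᵏ≤supNorm𝓑 : ∀ k → 2 ℕ.^ k ≤ supNorm 𝓑 k
  2ᵏ≤supNorm𝓑 k = begin
    2 ℕ.^ k                             ≡⟨ cong ∣_∣ (B₀ᵏ-entry₀₀≡2ᵏ k) ⟨
    ∣ prod 𝓑 (replicate k zero) 0F 0F ∣ ≤⟨ ∣entry₀₀∣≤‖‖∞ (prod 𝓑 (replicate k zero)) ⟩
    ‖ prod 𝓑 (replicate k zero) ‖∞      ≤⟨ ‖prod-replicate-zero‖∞≤supNorm 𝓑 k ⟩
    supNorm 𝓑 k                         ∎
    where open ≤-Reasoning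

lemma7p7 : JSR≡ 𝓑 2 × SimpleGrowth 𝓑 2
lemma7p7 =
    JSR≡-from-sandwich 𝓑 2 4 2ᵏ≤supNorm𝓑 (λ k → ‖prod‖∞≤b⇒supNorm≤b 𝓑 k ‖prod𝓑‖∞≤4*2ᵏ)
  , (4 , 0 , λ k _ → ‖prod𝓑‖∞≤4*2ᵏ)
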